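{- Let $k\ge 3$ and let $n$ be a positive integer with $n\equiv 0\pmod{\frac{4^k-1}{3}}$. Then there is no quaternary Hermitian LCD $[n,k,\alpha_4(n,k)]$ code. (Equivalently, writing $n=\frac{4^k-1}{3}s$, there is no quaternary Hermitian LCD $[\frac{4^k-1}{3}s,k,4^{k-1}s]$ code.)
   Context: $\mathbb{F}_4=\{0,1,\omega,\omega^2\}$ with $\omega^2=\omega+1$, $\overline{x}=x^2$. A quaternary $[n,k,d]$ code is a $k$-dimensional subspace of $\mathbb{F}_4^n$ with minimum nonzero Hamming weight $d$. Its Hermitian dual is $C^{\perp_H}=\{x : \sum_i x_i\overline{y_i}=0\ \forall y\in C\}$, and $C$ is Hermitian LCD if $C\cap C^{\perp_H}=\{0\}$. $\alpha_4(n,k)=\max\{d\in\mathbb{Z}_{\ge0} : n\ge\sum_{i=0}^{k-1}\lceil d/4^i\rceil\}$ (the Griesmer bound value). -}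

module Defs where

open import Data.Nat using (ℕ; zero; suc; _+_; _*_; _∸_; _^_; _≤_; _/_)
open import Data.Nat.Properties using (m^n≢0)
open import Data.Fin using (Fin)
open import Data.Product using (Σ; _×_; _,_)
open import Relation.Binary.PropositionalEquality using (_≡_; _≢_)
open import Relation.Nullary using (¬_)

data F4 : Set where
  𝟎 𝟏 ω ω² : F4

infixl 6 _⊕_
infixl 7 _⊗_

_⊕_ : F4 → F4 → F4
𝟎  ⊕ y  = y
x  ⊕ 𝟎  = x
𝟏  ⊕ 𝟏  = 𝟎
𝟏  ⊕ ω  = ω²
𝟏  ⊕ ω² = ω
ω  ⊕ 𝟏  = ω²
ω  ⊕ ω  = 𝟎
ω  ⊕ ω² = 𝟏
ω² ⊕ 𝟏  = ω
ω² ⊕ ω  = 𝟏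
ω² ⊕ ω² = 𝟎

_⊗_ : F4 → F4 → F4
𝟎  ⊗ y  = 𝟎
x  ⊗ 𝟎  = 𝟎
𝟏  ⊗ y  = y
x  ⊗ 𝟏  = x
ω  ⊗ ω  = ω²
ω  ⊗ ω² = 𝟏
ω² ⊗ ω  = 𝟏
ω² ⊗ ω² = ω

conj : F4 → F4
conj x = x ⊗ x

Vec4 : ℕ → Set
Vec4 n = Fin n → F4

zeroVec : ∀ {n} → Vec4 n
zeroVec _ = 𝟎

sumF : ∀ n → (Fin n → F4) → F4
sumF zero    f = 𝟎
sumF (suc n) f = f Fin.zero ⊕ sumF n (λ i → f (Fin.suc i))

wt : ∀ n → Vec4 n → ℕ
wt zero    x = 0
wt (suc n) x with x Fin.zero
... | 𝟎 = wt n (λ i → x (Fin.suc i))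
... | _ = suc (wt n (λ i → x (Fin.suc i)))

herm : ∀ {n} → Vec4 n → Vec4 n → F4
herm {n} x y = sumF n (λ i → x i ⊗ conj (y i))

-- Linear codes, given by a generator matrix G (k × n) with F4-linearly
-- independent rows; the code is the row space {c G : c ∈ F4^k},
-- a k-dimensional subspace of F4^n.

Matrix : ℕ → ℕ → Set
Matrix k n = Fin k → Fin n → F4

encode : ∀ {k n} → Matrix k n → Vec4 k → Vec4 n
encode {k} G c j = sumF k (λ i → c i ⊗ G i j)

LinIndepRows : ∀ {k n} → Matrix k n → Set
LinIndepRows {k} G = ∀ (c : Vec4 k) → (∀ j → encode G c j ≡ 𝟎) → ∀ i → c i ≡ 𝟎

_∈C_ : ∀ {k n} → Vec4 n → Matrix k n → Set
_∈C_ {k} {n} x G = Σ (Vec4 k) λ c → ∀ j → encode G c j ≡ x j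

IsZero : ∀ {n} → Vec4 n → Set
IsZero x = ∀ j → x j ≡ 𝟎

HasMinDist : ∀ {k n} → Matrix k n → ℕ → Set
HasMinDist {k} {n} G d =
  (Σ (Vec4 n) λ x → x ∈C G × ¬ IsZero x × wt n x ≡ d)
  × (∀ (x : Vec4 n) → x ∈C G → ¬ IsZero x → d ≤ wt n x)

HermitianLCD : ∀ {k n} → Matrix k n → Set
HermitianLCD {k} {n} G =
  ∀ (x : Vec4 n) → x ∈C G → (∀ (y : Vec4 n) → y ∈C G → herm x y ≡ 𝟎) → IsZero x

record HermLCDCode (n k d : ℕ) : Set where
  field
    gen     : Matrix k n
    indep   : LinIndepRows gen
    minDist : HasMinDist gen d
    lcd     : HermitianLCD gen

ceilDiv4^ : ℕ → ℕ → ℕ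
ceilDiv4^ d i = (d + 4 ^ i ∸ 1) / (4 ^ i)
  where instance _ = m^n≢0 4 i

griesmerSum : ℕ → ℕ → ℕ
griesmerSum zero    d = 0
griesmerSum (suc k) d = griesmerSum k d + ceilDiv4^ d k

IsAlpha4 : ℕ → ℕ → ℕ → Set
IsAlpha4 n k d = griesmerSum k d ≤ n × (∀ d' → griesmerSum k d' ≤ n → d' ≤ d)

-- Write n = s (4^k - 1)/3 and D = s 4^(k-1).  The Griesmer sum of D is exactly n, so
-- α₄(n,k) ≥ D.  Every coordinate of a k-dimensional code is nonzero in at most 3/4 of
-- its 4^k codewords, so the total weight is at most 3n 4^(k-1) = D (4^k - 1): the
-- Plotkin bound is attained and every nonzero codeword has weight exactly D.  For k ≥ 2
-- the weight D is even, and over F4 the Hermitian norm ⟨x,x⟩ = Σ xᵢ x̄ᵢ is the weight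
-- of x mod 2.  Hence every codeword is isotropic, so by polarization the code is
-- Hermitian self-orthogonal, and a nonzero self-orthogonal code is never LCD.
module Submission where

open import Defs
open import Data.Nat using (ℕ; _≤_; _∸_; _^_; _/_)
open import Data.Nat.Divisibility using (_∣_)
open import Relation.Nullary using (¬_)

open import Data.Fin as Fin using (Fin)
open import Data.Nat using (zero; suc; _+_; _*_; z≤n; s≤s; NonZero)
open import Data.Nat.Divisibility using (divides; _∣0; n∣m*n; ∣m⇒∣m*n; ∣n⇒∣m*n)
open import Data.Nat.DivMod using (m*n/n≡m; +-distrib-/-∣ˡ; m<n⇒m/n≡0)
open import Data.Nat.Properties hiding (_≟_)
open import Algebra.Properties.Monoid.Sum +-0-monoid using (sum; sum-cong-≗)
open import Data.Nat.Tactic.RingSolver using (solve-∀)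
open import Data.Product using (∃-syntax; _×_; _,_; proj₁; proj₂)
open import Data.Sum using (_⊎_; inj₁; inj₂)
open import Data.Vec.Functional using ([]; _∷_; head; tail)
open import Data.Vec.Functional.Properties using (∷-cong)
open import Function using (_∘_)
open import Relation.Binary.Core using (_Preserves_⟶_)
open import Relation.Binary.Definitions using (DecidableEquality)
open import Relation.Binary.PropositionalEquality
open import Relation.Nullary using (Dec; yes; no)
open import Relation.Nullary.Decidable using (map′; from-yes; _×-dec_; _→-dec_; ¬?)
open import Relation.Unary using (Decidable)

infix 4 _≟_
_≟_ : DecidableEquality F4
𝟎  ≟ 𝟎  = yes refl
𝟎  ≟ 𝟏  = no λ ()
𝟎  ≟ ω  = no λ ()
𝟎  ≟ ω² = no λ ()
𝟏  ≟ 𝟎  = no λ ()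
𝟏  ≟ 𝟏  = yes refl
𝟏  ≟ ω  = no λ ()
𝟏  ≟ ω² = no λ ()
ω  ≟ 𝟎  = no λ ()
ω  ≟ 𝟏  = no λ ()
ω  ≟ ω  = yes refl
ω  ≟ ω² = no λ ()
ω² ≟ 𝟎  = no λ ()
ω² ≟ 𝟏  = no λ ()
ω² ≟ ω  = no λ ()
ω² ≟ ω² = yes refl

all? : ∀ {p} {P : F4 → Set p} → Decidable P → Dec (∀ x → P x)
all? P? = map′ (λ (p₀ , p₁ , p₂ , p₃) → λ { 𝟎 → p₀ ; 𝟏 → p₁ ; ω → p₂ ; ω² → p₃ })
               (λ p → p 𝟎 , p 𝟏 , p ω , p ω²)
               (P? 𝟎 ×-dec P? 𝟏 ×-dec P? ω ×-dec P? ω²)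

tr : F4 → F4
tr u = u ⊕ conj u

⊕-interchange : ∀ a b c d → (a ⊕ b) ⊕ (c ⊕ d) ≡ (a ⊕ c) ⊕ (b ⊕ d)
⊕-interchange = from-yes (all? λ a → all? λ b → all? λ c → all? λ d →
  (a ⊕ b) ⊕ (c ⊕ d) ≟ (a ⊕ c) ⊕ (b ⊕ d))

⊗-zeroʳ : ∀ a → a ⊗ 𝟎 ≡ 𝟎
⊗-zeroʳ = from-yes (all? λ a → a ⊗ 𝟎 ≟ 𝟎)

⊗-distribˡ-⊕ : ∀ a x y → a ⊗ (x ⊕ y) ≡ a ⊗ x ⊕ a ⊗ y
⊗-distribˡ-⊕ = from-yes (all? λ a → all? λ x → all? λ y → a ⊗ (x ⊕ y) ≟ a ⊗ x ⊕ a ⊗ y)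

axpy-distribʳ : ∀ a x y g → (a ⊗ x ⊕ y) ⊗ g ≡ a ⊗ (x ⊗ g) ⊕ y ⊗ g
axpy-distribʳ = from-yes (all? λ a → all? λ x → all? λ y → all? λ g →
  (a ⊗ x ⊕ y) ⊗ g ≟ a ⊗ (x ⊗ g) ⊕ y ⊗ g)

conj-⊕ : ∀ x y → conj (x ⊕ y) ≡ conj x ⊕ conj y
conj-⊕ = from-yes (all? λ x → all? λ y → conj (x ⊕ y) ≟ conj x ⊕ conj y)

𝟏⊕-involutive : ∀ x → 𝟏 ⊕ (𝟏 ⊕ x) ≡ x
𝟏⊕-involutive = from-yes (all? λ x → 𝟏 ⊕ (𝟏 ⊕ x) ≟ x)

-- Holds because a ā = 1 for every a ≠ 0.
polarization : ∀ a x y → a ≢ 𝟎 →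
  (a ⊗ x ⊕ y) ⊗ conj (a ⊗ x ⊕ y) ≡ (x ⊗ conj x ⊕ y ⊗ conj y) ⊕ tr (a ⊗ (x ⊗ conj y))
polarization = from-yes (all? λ a → all? λ x → all? λ y → ¬? (a ≟ 𝟎) →-dec
  (a ⊗ x ⊕ y) ⊗ conj (a ⊗ x ⊕ y) ≟ (x ⊗ conj x ⊕ y ⊗ conj y) ⊕ tr (a ⊗ (x ⊗ conj y)))

tr-nondegenerate : ∀ u → tr (𝟏 ⊗ u) ≡ 𝟎 → tr (ω ⊗ u) ≡ 𝟎 → u ≡ 𝟎
tr-nondegenerate = from-yes (all? λ u → tr (𝟏 ⊗ u) ≟ 𝟎 →-dec tr (ω ⊗ u) ≟ 𝟎 →-dec u ≟ 𝟎)

wt₁ : F4 → ℕ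
wt₁ 𝟎 = 0
wt₁ _ = 1

sum₄ : (F4 → ℕ) → ℕ
sum₄ h = h 𝟎 + (h 𝟏 + (h ω + h ω²))

-- A nonzero affine map a ↦ a g + t permutes F4, so it vanishes exactly once.
sum₄-wt₁-affine : ∀ g t → g ≢ 𝟎 → sum₄ (λ a → wt₁ (a ⊗ g ⊕ t)) ≡ 3
sum₄-wt₁-affine = from-yes (all? λ g → all? λ t → ¬? (g ≟ 𝟎) →-dec
  sum₄ (λ a → wt₁ (a ⊗ g ⊕ t)) Data.Nat.≟ 3)

infix 10 _·𝟏
_·𝟏 : ℕ → F4
zero  ·𝟏 = 𝟎
suc m ·𝟏 = 𝟏 ⊕ m ·𝟏

even·𝟏≡𝟎 : ∀ j → (j * 2) ·𝟏 ≡ 𝟎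
even·𝟏≡𝟎 zero    = refl
even·𝟏≡𝟎 (suc j) = trans (𝟏⊕-involutive ((j * 2) ·𝟏)) (even·𝟏≡𝟎 j)

∣2⇒·𝟏≡𝟎 : ∀ {m} → 2 ∣ m → m ·𝟏 ≡ 𝟎
∣2⇒·𝟏≡𝟎 (divides j refl) = even·𝟏≡𝟎 j

sumF-cong : ∀ n {f g : Fin n → F4} → f ≗ g → sumF n f ≡ sumF n g
sumF-cong zero    _ = refl
sumF-cong (suc n) p = cong₂ _⊕_ (p Fin.zero) (sumF-cong n (p ∘ Fin.suc))

sumF-⊕ : ∀ n (f g : Fin n → F4) → sumF n (λ i → f i ⊕ g i) ≡ sumF n f ⊕ sumF n g
sumF-⊕ zero    f g = refl
sumF-⊕ (suc n) f g =
  trans (cong (f Fin.zero ⊕ g Fin.zero ⊕_) (sumF-⊕ n (tail f) (tail g)))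
        (⊕-interchange (f Fin.zero) (g Fin.zero) (sumF n (tail f)) (sumF n (tail g)))

sumF-scale : ∀ n a (f : Fin n → F4) → sumF n (λ i → a ⊗ f i) ≡ a ⊗ sumF n f
sumF-scale zero    a f = sym (⊗-zeroʳ a)
sumF-scale (suc n) a f =
  trans (cong (a ⊗ f Fin.zero ⊕_) (sumF-scale n a (tail f)))
        (sym (⊗-distribˡ-⊕ a (f Fin.zero) (sumF n (tail f))))

conj-sumF : ∀ n (f : Fin n → F4) → conj (sumF n f) ≡ sumF n (conj ∘ f)
conj-sumF zero    f = refl
conj-sumF (suc n) f =
  trans (conj-⊕ (f Fin.zero) (sumF n (tail f))) (cong (conj (f Fin.zero) ⊕_) (conj-sumF n (tail f)))

sumF-tr : ∀ n (f : Fin n → F4) → sumF n (tr ∘ f) ≡ tr (sumF n f)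
sumF-tr n f = trans (sumF-⊕ n f (conj ∘ f)) (cong (sumF n f ⊕_) (sym (conj-sumF n f)))

wt≡sum-wt₁ : ∀ n (x : Vec4 n) → wt n x ≡ sum (wt₁ ∘ x)
wt≡sum-wt₁ zero    x = refl
wt≡sum-wt₁ (suc n) x with x Fin.zero
... | 𝟎  = wt≡sum-wt₁ n (tail x)
... | 𝟏  = cong suc (wt≡sum-wt₁ n (tail x))
... | ω  = cong suc (wt≡sum-wt₁ n (tail x))
... | ω² = cong suc (wt≡sum-wt₁ n (tail x))

wt-cong : ∀ n → wt n Preserves _≗_ ⟶ _≡_
wt-cong n {x} {y} x≗y =
  trans (wt≡sum-wt₁ n x) (trans (sum-cong-≗ (cong wt₁ ∘ x≗y)) (sym (wt≡sum-wt₁ n y)))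

herm-cong : ∀ {n} {x x′ y y′ : Vec4 n} → x ≗ x′ → y ≗ y′ → herm x y ≡ herm x′ y′
herm-cong {n} p q = sumF-cong n (λ i → cong₂ (λ a b → a ⊗ conj b) (p i) (q i))

herm-self≡wt·𝟏 : ∀ n (z : Vec4 n) → herm z z ≡ wt n z ·𝟏
herm-self≡wt·𝟏 zero    z = refl
herm-self≡wt·𝟏 (suc n) z with z Fin.zero
... | 𝟎  = herm-self≡wt·𝟏 n (tail z)
... | 𝟏  = cong (𝟏 ⊕_) (herm-self≡wt·𝟏 n (tail z))
... | ω  = cong (𝟏 ⊕_) (herm-self≡wt·𝟏 n (tail z))
... | ω² = cong (𝟏 ⊕_) (herm-self≡wt·𝟏 n (tail z))

encode-cong : ∀ {k n} (G : Matrix k n) {c c′ : Vec4 k} → c ≗ c′ → encode G c ≗ encode G c′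
encode-cong {k} G c≗c′ j = sumF-cong k (λ i → cong (_⊗ G i j) (c≗c′ i))

encode-axpy : ∀ {k n} (G : Matrix k n) a (c c′ : Vec4 k) j →
  encode G (λ i → a ⊗ c i ⊕ c′ i) j ≡ a ⊗ encode G c j ⊕ encode G c′ j
encode-axpy {k} G a c c′ j = begin
  sumF k (λ i → (a ⊗ c i ⊕ c′ i) ⊗ G i j)
    ≡⟨ sumF-cong k (λ i → axpy-distribʳ a (c i) (c′ i) (G i j)) ⟩
  sumF k (λ i → a ⊗ (c i ⊗ G i j) ⊕ c′ i ⊗ G i j)
    ≡⟨ sumF-⊕ k _ _ ⟩
  sumF k (λ i → a ⊗ (c i ⊗ G i j)) ⊕ encode G c′ j
    ≡⟨ cong (_⊕ encode G c′ j) (sumF-scale k a _) ⟩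
  a ⊗ encode G c j ⊕ encode G c′ j ∎
  where open ≡-Reasoning

∈C-axpy : ∀ {k n} {G : Matrix k n} a {x y : Vec4 n} → x ∈C G → y ∈C G → (λ j → a ⊗ x j ⊕ y j) ∈C G
∈C-axpy {G = G} a (c , c↦x) (c′ , c′↦y) =
  (λ i → a ⊗ c i ⊕ c′ i) , λ j → trans (encode-axpy G a c c′ j) (cong₂ (λ u v → a ⊗ u ⊕ v) (c↦x j) (c′↦y j))

herm-polarization : ∀ {n} a (x y : Vec4 n) → a ≢ 𝟎 →
  herm (λ j → a ⊗ x j ⊕ y j) (λ j → a ⊗ x j ⊕ y j) ≡ (herm x x ⊕ herm y y) ⊕ tr (a ⊗ herm x y)
herm-polarization {n} a x y a≢𝟎 = begin
  sumF n (λ i → (a ⊗ x i ⊕ y i) ⊗ conj (a ⊗ x i ⊕ y i))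
    ≡⟨ sumF-cong n (λ i → polarization a (x i) (y i) a≢𝟎) ⟩
  sumF n (λ i → (x i ⊗ conj (x i) ⊕ y i ⊗ conj (y i)) ⊕ tr (a ⊗ (x i ⊗ conj (y i))))
    ≡⟨ sumF-⊕ n _ _ ⟩
  sumF n (λ i → x i ⊗ conj (x i) ⊕ y i ⊗ conj (y i)) ⊕ sumF n (λ i → tr (a ⊗ (x i ⊗ conj (y i))))
    ≡⟨ cong₂ _⊕_ (sumF-⊕ n _ _) (trans (sumF-tr n _) (cong tr (sumF-scale n a _))) ⟩
  (herm x x ⊕ herm y y) ⊕ tr (a ⊗ herm x y) ∎
  where open ≡-Reasoning

selfOrthogonal⇒orthogonal : ∀ {k n} (G : Matrix k n) → (∀ z → z ∈C G → herm z z ≡ 𝟎) →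
  ∀ x y → x ∈C G → y ∈C G → herm x y ≡ 𝟎
selfOrthogonal⇒orthogonal G isotropic x y x∈C y∈C =
  tr-nondegenerate (herm x y) (tr-vanishes 𝟏 λ ()) (tr-vanishes ω λ ())
  where
  open ≡-Reasoning
  tr-vanishes : ∀ a → a ≢ 𝟎 → tr (a ⊗ herm x y) ≡ 𝟎
  tr-vanishes a a≢𝟎 = begin
    tr (a ⊗ herm x y)
      ≡⟨ cong₂ (λ u v → (u ⊕ v) ⊕ tr (a ⊗ herm x y)) (isotropic x x∈C) (isotropic y y∈C) ⟨
    (herm x x ⊕ herm y y) ⊕ tr (a ⊗ herm x y)
      ≡⟨ herm-polarization a x y a≢𝟎 ⟨
    herm (λ j → a ⊗ x j ⊕ y j) (λ j → a ⊗ x j ⊕ y j)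
      ≡⟨ isotropic _ (∈C-axpy a x∈C y∈C) ⟩
    𝟎 ∎

evenCode⇒selfOrthogonal : ∀ {k n} (G : Matrix k n) → (∀ c → 2 ∣ wt n (encode G c)) →
  ∀ x y → x ∈C G → y ∈C G → herm x y ≡ 𝟎
evenCode⇒selfOrthogonal {n = n} G even = selfOrthogonal⇒orthogonal G isotropic
  where
  isotropic : ∀ z → z ∈C G → herm z z ≡ 𝟎
  isotropic z (c , c↦z) = begin
    herm z z                       ≡⟨ herm-cong (sym ∘ c↦z) (sym ∘ c↦z) ⟩
    herm (encode G c) (encode G c) ≡⟨ herm-self≡wt·𝟏 n (encode G c) ⟩
    wt n (encode G c) ·𝟏           ≡⟨ ∣2⇒·𝟏≡𝟎 (even c) ⟩
    𝟎                              ∎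
    where open ≡-Reasoning

nonzeroEvenCode⇒¬LCD : ∀ {k n} (G : Matrix k n) → (∀ c → 2 ∣ wt n (encode G c)) →
  ∀ x → x ∈C G → ¬ IsZero x → ¬ HermitianLCD G
nonzeroEvenCode⇒¬LCD G even x x∈C x≢𝟎 lcd = x≢𝟎 (lcd x x∈C λ y → evenCode⇒selfOrthogonal G even x y x∈C)

sumAll : ∀ k → (Vec4 k → ℕ) → ℕ
sumAll zero    f = f []
sumAll (suc k) f = sum₄ (λ a → sumAll k (f ∘ (a ∷_)))

sum₄-cong : ∀ {h h′ : F4 → ℕ} → h ≗ h′ → sum₄ h ≡ sum₄ h′
sum₄-cong p = cong₂ _+_ (p 𝟎) (cong₂ _+_ (p 𝟏) (cong₂ _+_ (p ω) (p ω²)))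

sum₄-mono : ∀ {h h′ : F4 → ℕ} → (∀ a → h a ≤ h′ a) → sum₄ h ≤ sum₄ h′
sum₄-mono p = +-mono-≤ (p 𝟎) (+-mono-≤ (p 𝟏) (+-mono-≤ (p ω) (p ω²)))

sum₄-+ : ∀ (h h′ : F4 → ℕ) → sum₄ (λ a → h a + h′ a) ≡ sum₄ h + sum₄ h′
sum₄-+ h h′ = eq (h 𝟎) (h 𝟏) (h ω) (h ω²) (h′ 𝟎) (h′ 𝟏) (h′ ω) (h′ ω²)
  where
  eq : ∀ a b c d a′ b′ c′ d′ →
    (a + a′) + ((b + b′) + ((c + c′) + (d + d′))) ≡ (a + (b + (c + d))) + (a′ + (b′ + (c′ + d′)))
  eq = solve-∀

sumAll-cong : ∀ k {f g : Vec4 k → ℕ} → f ≗ g → sumAll k f ≡ sumAll k g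
sumAll-cong zero    p = p []
sumAll-cong (suc k) p = sum₄-cong (λ a → sumAll-cong k (p ∘ (a ∷_)))

sumAll-mono : ∀ k {f g : Vec4 k → ℕ} → (∀ c → f c ≤ g c) → sumAll k f ≤ sumAll k g
sumAll-mono zero    p = p []
sumAll-mono (suc k) p = sum₄-mono (λ a → sumAll-mono k (p ∘ (a ∷_)))

sumAll-+ : ∀ k (f g : Vec4 k → ℕ) → sumAll k (λ c → f c + g c) ≡ sumAll k f + sumAll k g
sumAll-+ zero    f g = refl
sumAll-+ (suc k) f g =
  trans (sum₄-cong (λ a → sumAll-+ k (f ∘ (a ∷_)) (g ∘ (a ∷_))))
        (sum₄-+ (λ a → sumAll k (f ∘ (a ∷_))) (λ a → sumAll k (g ∘ (a ∷_))))

sumAll-const : ∀ k m → sumAll k (λ _ → m) ≡ m * 4 ^ k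
sumAll-const zero    m = sym (*-identityʳ m)
sumAll-const (suc k) m = trans (cong (λ s → s + (s + (s + s))) (sumAll-const k m)) (eq m (4 ^ k))
  where
  eq : ∀ m p → m * p + (m * p + (m * p + m * p)) ≡ m * (4 * p)
  eq = solve-∀

sumAll-sum₄ : ∀ k (h : F4 → Vec4 k → ℕ) → sumAll k (λ c → sum₄ (λ a → h a c)) ≡ sum₄ (λ a → sumAll k (h a))
sumAll-sum₄ k h =
  trans (sumAll-+ k (h 𝟎) _) (cong (sumAll k (h 𝟎) +_)
   (trans (sumAll-+ k (h 𝟏) _) (cong (sumAll k (h 𝟏) +_)
    (sumAll-+ k (h ω) (h ω²)))))

sumAll-sum : ∀ k n (h : Vec4 k → Fin n → ℕ) → sumAll k (λ c → sum (h c)) ≡ sum (λ j → sumAll k (λ c → h c j))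
sumAll-sum k zero    h = sumAll-const k 0
sumAll-sum k (suc n) h =
  trans (sumAll-+ k (λ c → h c Fin.zero) (λ c → sum (tail (h c))))
        (cong (sumAll k (λ c → h c Fin.zero) +_) (sumAll-sum k n (λ c → tail (h c))))

+-≤-split : ∀ {a b c d} → a ≤ b → c ≤ d → b + d ≤ a + c → b ≤ a × d ≤ c
+-≤-split {a} {b} {c} {d} a≤b c≤d b+d≤a+c =
  +-cancelʳ-≤ d b a (≤-trans b+d≤a+c (+-monoʳ-≤ a c≤d)) ,
  +-cancelˡ-≤ b d c (≤-trans b+d≤a+c (+-monoˡ-≤ c a≤b))

sum₄-tight : ∀ {h h′ : F4 → ℕ} → (∀ a → h a ≤ h′ a) → sum₄ h′ ≤ sum₄ h → ∀ a → h′ a ≤ h a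
sum₄-tight p le
  with h′𝟎≤ , rest₁ ← +-≤-split (p 𝟎) (+-mono-≤ (p 𝟏) (+-mono-≤ (p ω) (p ω²))) le
  with h′𝟏≤ , rest₂ ← +-≤-split (p 𝟏) (+-mono-≤ (p ω) (p ω²)) rest₁
  with h′ω≤ , h′ω²≤ ← +-≤-split (p ω) (p ω²) rest₂
  = λ { 𝟎 → h′𝟎≤ ; 𝟏 → h′𝟏≤ ; ω → h′ω≤ ; ω² → h′ω²≤ }

-- The congruence hypotheses are needed because head c ∷ tail c is only pointwise equal to c.
sumAll-tight : ∀ k {f g : Vec4 k → ℕ} → f Preserves _≗_ ⟶ _≡_ → g Preserves _≗_ ⟶ _≡_ →
  (∀ c → f c ≤ g c) → sumAll k g ≤ sumAll k f → ∀ c → g c ≤ f c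
sumAll-tight zero    f-cong g-cong f≤g le c = subst₂ _≤_ (g-cong λ ()) (f-cong λ ()) le
sumAll-tight (suc k) {f} {g} f-cong g-cong f≤g le c =
  subst₂ _≤_ (g-cong c-eta) (f-cong c-eta) (sumAll-tight k
    (f-cong ∘ ∷-cong refl) (g-cong ∘ ∷-cong refl) (f≤g ∘ (head c ∷_))
    (sum₄-tight (λ a → sumAll-mono k (f≤g ∘ (a ∷_))) le (head c)) (tail c))
  where
  c-eta : (head c ∷ tail c) ≗ c
  c-eta = ∷-cong refl (λ _ → refl)

ifZero : F4 → ℕ → ℕ
ifZero 𝟎 r = r
ifZero _ r = 0

𝟙₀ : ∀ k → Vec4 k → ℕ
𝟙₀ zero    c = 1
𝟙₀ (suc k) c = ifZero (head c) (𝟙₀ k (tail c))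

𝟙₀-cong : ∀ k → 𝟙₀ k Preserves _≗_ ⟶ _≡_
𝟙₀-cong zero    _ = refl
𝟙₀-cong (suc k) p = cong₂ ifZero (p Fin.zero) (𝟙₀-cong k (p ∘ Fin.suc))

𝟙₀-zero : ∀ k {c : Vec4 k} → IsZero c → 𝟙₀ k c ≡ 1
𝟙₀-zero zero    _ = refl
𝟙₀-zero (suc k) {c} c≡𝟎 rewrite c≡𝟎 Fin.zero = 𝟙₀-zero k (c≡𝟎 ∘ Fin.suc)

sumAll-𝟙₀* : ∀ k m → sumAll k (λ c → 𝟙₀ k c * m) ≡ m
sumAll-𝟙₀* zero    m = +-identityʳ m
sumAll-𝟙₀* (suc k) m =
  trans (cong₂ (λ s z → s + (z + (z + z))) (sumAll-𝟙₀* k m) (sumAll-const k 0)) (+-identityʳ m)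

columnWeight-bound : ∀ k (g : Vec4 k) → 4 * sumAll k (λ c → wt₁ (sumF k (λ i → c i ⊗ g i))) ≤ 3 * 4 ^ k
columnWeight-bound zero    g = z≤n
columnWeight-bound (suc k) g with head g ≟ 𝟎
... | yes g₀≡𝟎 rewrite g₀≡𝟎 =
  subst₂ _≤_ (eq₁ (sumAll k (λ c → wt₁ (sumF k (λ i → c i ⊗ tail g i))))) (eq₂ (4 ^ k))
    (*-monoʳ-≤ 4 (columnWeight-bound k (tail g)))
  where
  eq₁ : ∀ s → 4 * (4 * s) ≡ 4 * (s + (s + (s + s)))
  eq₁ = solve-∀
  eq₂ : ∀ p → 4 * (3 * p) ≡ 3 * (4 * p)
  eq₂ = solve-∀
... | no g₀≢𝟎 = ≤-reflexive (begin
  4 * sum₄ (λ a → sumAll k (λ c → wt₁ (a ⊗ head g ⊕ t c)))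
    ≡⟨ cong (4 *_) (sumAll-sum₄ k (λ a c → wt₁ (a ⊗ head g ⊕ t c))) ⟨
  4 * sumAll k (λ c → sum₄ (λ a → wt₁ (a ⊗ head g ⊕ t c)))
    ≡⟨ cong (4 *_) (trans (sumAll-cong k (λ c → sum₄-wt₁-affine (head g) (t c) g₀≢𝟎)) (sumAll-const k 3)) ⟩
  4 * (3 * 4 ^ k)
    ≡⟨ eq (4 ^ k) ⟩
  3 * 4 ^ suc k ∎)
  where
  open ≡-Reasoning
  eq : ∀ p → 4 * (3 * p) ≡ 3 * (4 * p)
  eq = solve-∀
  t : Vec4 k → F4
  t c = sumF k (λ i → c i ⊗ tail g i)

sum-bound : ∀ {n} a B (h : Fin n → ℕ) → (∀ j → a * h j ≤ B) → a * sum h ≤ n * B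
sum-bound {zero}  a B h _ = ≤-reflexive (*-zeroʳ a)
sum-bound {suc n} a B h p =
  subst (_≤ suc n * B) (sym (*-distribˡ-+ a (h Fin.zero) (sum (tail h))))
    (+-mono-≤ (p Fin.zero) (sum-bound a B (tail h) (p ∘ Fin.suc)))

totalWeight-bound : ∀ {k n} (G : Matrix k n) → 4 * sumAll k (λ c → wt n (encode G c)) ≤ n * (3 * 4 ^ k)
totalWeight-bound {k} {n} G =
  subst (_≤ n * (3 * 4 ^ k))
    (cong (4 *_) (sym (trans (sumAll-cong k (λ c → wt≡sum-wt₁ n (encode G c)))
                              (sumAll-sum k n (λ c j → wt₁ (encode G c j))))))
    (sum-bound 4 (3 * 4 ^ k) _ (λ j → columnWeight-bound k (λ i → G i j)))

+-*-≡-dichotomy : ∀ w z D → w + z * D ≡ D → w ≡ D ⊎ w ≡ 0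
+-*-≡-dichotomy w zero    D eq = inj₁ (trans (sym (+-identityʳ w)) eq)
+-*-≡-dichotomy w (suc z) D eq =
  inj₂ (n≤0⇒n≡0 (+-cancelʳ-≤ D w 0 (≤-trans (+-monoʳ-≤ w (m≤m+n D (z * D))) (≤-reflexive eq))))

∣-of-≡⊎≡0 : ∀ {a w D} → a ∣ D → w ≡ D ⊎ w ≡ 0 → a ∣ w
∣-of-≡⊎≡0 a∣D (inj₁ refl) = a∣D
∣-of-≡⊎≡0 _   (inj₂ refl) = _ ∣0

-- The hypothesis on n reverses the Plotkin bound 4D (4^k - 1) ≤ 3n 4^k.  Adding D at the zero
-- message gives a function g ≥ D whose sum over all 4^k messages is at most D 4^k, so g ≡ D.
plotkin-constantWeight : ∀ {k n} (G : Matrix k n) D →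
  (∀ c → ¬ IsZero c → D ≤ wt n (encode G c)) →
  n * (3 * 4 ^ k) + 4 * D ≤ 4 * D * 4 ^ k →
  ∀ c → wt n (encode G c) ≡ D ⊎ wt n (encode G c) ≡ 0
plotkin-constantWeight {k} {n} G D D≤wt plotkin c =
  +-*-≡-dichotomy (w c) (𝟙₀ k c) D (≤-antisym (g≤D c) (D≤g c))
  where
  w g : Vec4 k → ℕ
  w c = wt n (encode G c)
  g c = w c + 𝟙₀ k c * D

  D≤g : ∀ c → D ≤ g c
  D≤g c with 𝟙₀ k c in 𝟙₀≡
  ... | zero  = ≤-trans (D≤wt c λ c≡𝟎 → 0≢1+n (trans (sym 𝟙₀≡) (𝟙₀-zero k c≡𝟎))) (m≤m+n (w c) 0)
  ... | suc z = ≤-trans (m≤m+n D (z * D)) (m≤n+m (D + z * D) (w c))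

  sum-g≤sum-D : sumAll k g ≤ sumAll k (λ _ → D)
  sum-g≤sum-D = begin
    sumAll k g                ≡⟨ sumAll-+ k w (λ c → 𝟙₀ k c * D) ⟩
    sumAll k w + sumAll k (λ c → 𝟙₀ k c * D) ≡⟨ cong (sumAll k w +_) (sumAll-𝟙₀* k D) ⟩
    sumAll k w + D            ≤⟨ *-cancelˡ-≤ 4 (begin
      4 * (sumAll k w + D)       ≡⟨ *-distribˡ-+ 4 (sumAll k w) D ⟩
      4 * sumAll k w + 4 * D     ≤⟨ +-monoˡ-≤ (4 * D) (totalWeight-bound G) ⟩
      n * (3 * 4 ^ k) + 4 * D    ≤⟨ plotkin ⟩
      4 * D * 4 ^ k              ≡⟨ *-assoc 4 D (4 ^ k) ⟩
      4 * (D * 4 ^ k)            ∎) ⟩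
    D * 4 ^ k                 ≡⟨ sumAll-const k D ⟨
    sumAll k (λ _ → D)        ∎
    where open ≤-Reasoning

  g≤D : ∀ c → g c ≤ D
  g≤D = sumAll-tight k (λ _ → refl)
    (λ c≗c′ → cong₂ _+_ (wt-cong n (encode-cong G c≗c′)) (cong (_* D) (𝟙₀-cong k c≗c′)))
    D≤g sum-g≤sum-D

ceil-exact : ∀ p P .{{_ : NonZero P}} → (p * P + P ∸ 1) / P ≡ p
ceil-exact p P@(suc P′) = begin
  (p * P + P ∸ 1) / P  ≡⟨ cong (_/ P) (+-∸-assoc (p * P) (s≤s z≤n)) ⟩
  (p * P + P′) / P     ≡⟨ +-distrib-/-∣ˡ P′ (n∣m*n p) ⟩
  p * P / P + P′ / P   ≡⟨ cong₂ _+_ (m*n/n≡m p P) (m<n⇒m/n≡0 ≤-refl) ⟩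
  p + 0                ≡⟨ +-identityʳ p ⟩
  p                    ∎
  where open ≡-Reasoning

ceilDiv4^-exact : ∀ p i → ceilDiv4^ (p * 4 ^ i) i ≡ p
ceilDiv4^-exact p i = ceil-exact p (4 ^ i) {{m^n≢0 4 i}}

griesmerSum-geometric : ∀ K q → 3 * griesmerSum (suc K) (q * 4 ^ K) + q ≡ q * 4 ^ suc K
griesmerSum-geometric zero q =
  trans (cong (λ s → 3 * s + q) (ceilDiv4^-exact q 0)) (eq q)
  where
  eq : ∀ q → 3 * q + q ≡ q * (4 * 1)
  eq = solve-∀
griesmerSum-geometric (suc K) q = begin
  3 * (griesmerSum (suc K) (q * 4 ^ suc K) + ceilDiv4^ (q * 4 ^ suc K) (suc K)) + q
    ≡⟨ cong (λ s → 3 * (griesmerSum (suc K) (q * 4 ^ suc K) + s) + q) (ceilDiv4^-exact q (suc K)) ⟩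
  3 * (griesmerSum (suc K) (q * 4 ^ suc K) + q) + q
    ≡⟨ eq₁ (griesmerSum (suc K) (q * 4 ^ suc K)) q ⟩
  3 * griesmerSum (suc K) (q * (4 * 4 ^ K)) + q * 4
    ≡⟨ cong (λ d → 3 * griesmerSum (suc K) d + q * 4) (eq₂ q (4 ^ K)) ⟩
  3 * griesmerSum (suc K) (q * 4 * 4 ^ K) + q * 4
    ≡⟨ griesmerSum-geometric K (q * 4) ⟩
  q * 4 * 4 ^ suc K
    ≡⟨ eq₃ q (4 ^ K) ⟩
  q * 4 ^ suc (suc K) ∎
  where
  open ≡-Reasoning
  eq₁ : ∀ g q → 3 * (g + q) + q ≡ 3 * g + q * 4
  eq₁ = solve-∀
  eq₂ : ∀ q p → q * (4 * p) ≡ q * 4 * p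
  eq₂ = solve-∀
  eq₃ : ∀ q p → q * 4 * (4 * p) ≡ q * (4 * (4 * p))
  eq₃ = solve-∀

4^k≡1-mod-3 : ∀ k → ∃[ t ] 4 ^ k ≡ 1 + t * 3
4^k≡1-mod-3 zero = 0 , refl
4^k≡1-mod-3 (suc k) with 4^k≡1-mod-3 k
... | t , eq = 1 + 4 * t , trans (cong (4 *_) eq) (eq′ t)
  where
  eq′ : ∀ t → 4 * (1 + t * 3) ≡ 1 + (1 + 4 * t) * 3
  eq′ = solve-∀

1+[4^k∸1]/3*3≡4^k : ∀ k → 1 + (4 ^ k ∸ 1) / 3 * 3 ≡ 4 ^ k
1+[4^k∸1]/3*3≡4^k k with 4^k≡1-mod-3 k
... | t , eq = begin
  1 + (4 ^ k ∸ 1) / 3 * 3  ≡⟨ cong (λ p → 1 + (p ∸ 1) / 3 * 3) eq ⟩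
  1 + t * 3 / 3 * 3        ≡⟨ cong (λ s → 1 + s * 3) (m*n/n≡m t 3) ⟩
  1 + t * 3                ≡⟨ eq ⟨
  4 ^ k                    ∎
  where open ≡-Reasoning

module _ (K s : ℕ) where
  private
    m = (4 ^ suc K ∸ 1) / 3

  griesmerSum-attained : griesmerSum (suc K) (s * 4 ^ K) ≡ s * m
  griesmerSum-attained = *-cancelˡ-≡ _ _ 3 (+-cancelʳ-≡ s _ _ (begin
    3 * griesmerSum (suc K) (s * 4 ^ K) + s ≡⟨ griesmerSum-geometric K s ⟩
    s * 4 ^ suc K                          ≡⟨ cong (s *_) (1+[4^k∸1]/3*3≡4^k (suc K)) ⟨
    s * (1 + m * 3)                        ≡⟨ eq s m ⟩
    3 * (s * m) + s                        ∎))
    where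
    open ≡-Reasoning
    eq : ∀ s m → s * (1 + m * 3) ≡ 3 * (s * m) + s
    eq = solve-∀

  plotkin-attained : s * m * (3 * 4 ^ suc K) + 4 * (s * 4 ^ K) ≡ 4 * (s * 4 ^ K) * 4 ^ suc K
  plotkin-attained = begin
    s * m * (3 * 4 ^ suc K) + 4 * (s * 4 ^ K) ≡⟨ eq₁ s m (4 ^ K) ⟩
    s * 4 ^ suc K * (1 + m * 3)               ≡⟨ cong (s * 4 ^ suc K *_) (1+[4^k∸1]/3*3≡4^k (suc K)) ⟩
    s * 4 ^ suc K * 4 ^ suc K                 ≡⟨ eq₂ s (4 ^ K) ⟩
    4 * (s * 4 ^ K) * 4 ^ suc K               ∎
    where
    open ≡-Reasoning
    eq₁ : ∀ s m p → s * m * (3 * (4 * p)) + 4 * (s * p) ≡ s * (4 * p) * (1 + m * 3)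
    eq₁ = solve-∀
    eq₂ : ∀ s p → s * (4 * p) * (4 * p) ≡ 4 * (s * p) * (4 * p)
    eq₂ = solve-∀

theorem3p3 : ∀ (k n : ℕ) → 3 ≤ k → 1 ≤ n → ((4 ^ k ∸ 1) / 3) ∣ n →
    ∀ (d : ℕ) → IsAlpha4 n k d → ¬ HermLCDCode n k d
theorem3p3 (suc K@(suc K′)) n (s≤s (s≤s _)) _ (divides s n≡s*m) _ (_ , maximal) code =
  let (x , x∈C , x≢𝟎 , _) = proj₁ minDist in nonzeroEvenCode⇒¬LCD gen evenWeights x x∈C x≢𝟎 lcd
  where
  open HermLCDCode code
  D = s * 4 ^ K

  D≤wt : ∀ c → ¬ IsZero c → D ≤ wt n (encode gen c)
  D≤wt c c≢𝟎 = ≤-trans (maximal D (≤-reflexive (trans (griesmerSum-attained K s) (sym n≡s*m))))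
                       (proj₂ minDist (encode gen c) (c , λ _ → refl) (c≢𝟎 ∘ indep c))

  weights : ∀ c → wt n (encode gen c) ≡ D ⊎ wt n (encode gen c) ≡ 0
  weights = plotkin-constantWeight gen D D≤wt
    (≤-reflexive (trans (cong (λ n → n * (3 * 4 ^ suc K) + 4 * D) n≡s*m) (plotkin-attained K s)))

  evenWeights : ∀ c → 2 ∣ wt n (encode gen c)
  evenWeights c = ∣-of-≡⊎≡0 (∣n⇒∣m*n s (∣m⇒∣m*n (4 ^ K′) (divides 2 refl))) (weights c)
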